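{- Let $f \in \mathbb{Z}[x]$ be a non-constant polynomial and let $g(x) = f(x)^2 + 3$. Then for almost all $z \in \mathbb{Z}_{>0}$ (i.e. all outside a set of density zero) we have $$\log \mathrm{sf}(g(z)) \gg \log z,$$ where the implied constant depends on $f$.
   Context: For a positive integer $d$, written uniquely as $d = d_1 d_2^2$ with $d_1$ square-free, $\mathrm{sf}(d) := d_1$ is the square-free part of $d$. -}

module Defs where

open import Data.Nat using (ℕ; zero; suc; _+_; _*_; _^_; _≤_; _<_)
open import Data.Nat.Divisibility using (_∣_)
open import Data.Integer as ℤ using (ℤ; ∣_∣)
open import Data.List using (List; []; _∷_; drop; length)
open import Data.List.Relation.Unary.Any using (Any)
open import Data.List.Relation.Unary.All using (All)
open import Data.List.Relation.Unary.Unique.Propositional using (Unique)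
open import Data.Product using (Σ; ∃; ∃-syntax; _×_)
open import Relation.Binary.PropositionalEquality using (_≡_; _≢_)

-- A polynomial in ℤ[x] is given by its coefficient list [a₀, a₁, …, aₙ]
-- (trailing zeros allowed), representing a₀ + a₁ x + … + aₙ xⁿ.
Poly : Set
Poly = List ℤ

eval : Poly → ℤ → ℤ
eval []       x = ℤ.0ℤ
eval (a ∷ as) x = a ℤ.+ x ℤ.* eval as x

NonConstant : Poly → Set
NonConstant f = Any (λ a → a ≢ ℤ.0ℤ) (drop 1 f)

-- g(z) = f(z)² + 3, as a natural number (it is always ≥ 3 > 0).
gval : Poly → ℕ → ℕ
gval f z = ∣ eval f (ℤ.+ z) ℤ.* eval f (ℤ.+ z) ℤ.+ ℤ.+ 3 ∣

SquareFree : ℕ → Set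
SquareFree d = ∀ k → k * k ∣ d → k ≡ 1

-- d₁ is the square-free part sf(d) of d: d = d₁ d₂² with d₁ square-free
-- (this decomposition is unique for d > 0).
IsSfPart : ℕ → ℕ → Set
IsSfPart d d₁ = SquareFree d₁ × ∃[ d₂ ] (d ≡ d₁ * (d₂ * d₂))

DensityZero : (ℕ → Set) → Set
DensityZero P =
  ∀ (k : ℕ) → ∃[ X₀ ] ∀ (X : ℕ) → X₀ ≤ X →
    ∀ (zs : List ℕ) → Unique zs → All (λ z → 1 ≤ z × z ≤ X × P z) zs →
    suc k * length zs ≤ X

{-# OPTIONS --safe #-}
module Submission where

-- Take N = 2. Beyond some Z₀ the map z ↦ |f(z)| is injective with values ≥ 2; write
-- |f(z)|² + 3 = d e² with d = sf(g(z)). If d² < z ≤ X then d < √X. For a fixed d, two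
-- solutions x₁² + 3 = d e₁² and x₂² + 3 = d e₂² with e₁ < e₂ satisfy
-- (x₂e₁)² − (x₁e₂)² = 3(e₂² − e₁²), which forces 4e₁ < 3e₂ and hence 2e₁³ < e₂³. So for fixed d
-- the e³ lie in pairwise distinct dyadic ranges [2ʲ, 2ʲ⁺¹), of which there are O(log X) because
-- e ≤ |f(z)| ≤ X^O(1). Thus z is determined by d and the range of e³, and at most
-- Z₀ + O(√X log X) = o(X) integers z ≤ X have sf(g(z))² < z.

open import Defs
open import Data.Fin using (Fin; toℕ; fromℕ<)
open import Data.Fin.Properties using (pigeonhole; toℕ-fromℕ<; +↔⊎; *↔×)
import Data.Fin.Properties as Finₚ
open import Data.List as List using (List; []; _∷_; length; map)
open import Data.List.Membership.Propositional.Properties using (∈-lookup)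
open import Data.List.Relation.Unary.All as All using (All)
open import Data.List.Relation.Unary.All.Properties using (All¬⇒¬Any)
import Data.List.Relation.Unary.AllPairs as AllPairs
open import Data.List.Relation.Unary.Unique.Propositional using (Unique)
open import Data.Product using (∃; ∃-syntax; _×_; _,_; proj₁; proj₂; map₂)
open import Data.Sum using (_⊎_; inj₁; inj₂) renaming (map to map⊎)
open import Data.Sum.Function.Propositional using (_⊎-↔_)
open import Function using (_∘′_)
open import Function.Bundles using (_↣_; Injection)
open import Function.Properties.Inverse using (↔-refl; ↔-sym; ↔-trans; ↔⇒↣)
open import Relation.Binary.Definitions using (tri<; tri≈; tri>)
open import Relation.Binary.PropositionalEquality
open import Relation.Nullary using (¬_; yes; no; contradiction)
open import Relation.Nullary.Decidable using (_×-dec_)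

module IntegerPolynomial where

  open import Data.Integer
    using (ℤ; +_; +[1+_]; -[1+_]; ∣_∣; 0ℤ; 1ℤ; -_; _+_; _*_; _⊖_; _≤_; _<_; +≤+; +<+)
  open import Data.Integer.Properties
  open import Data.List.Relation.Unary.All using ([]; _∷_)
  open import Data.Nat as ℕ using (ℕ; suc; _⊔_; s≤s; z≤n)
  import Data.Nat.Properties as ℕ
  open import Data.Nat.ListAction using (sum)
  open import Data.Nat.Tactic.RingSolver using (solve-∀)

  Eventually : (ℕ → Set) → Set
  Eventually P = ∃[ Z ] ∀ z → Z ℕ.≤ z → P z

  Eventually-map : ∀ {P Q : ℕ → Set} → (∀ {z} → P z → Q z) → Eventually P → Eventually Q
  Eventually-map P⇒Q (Z , P-from-Z) = Z , λ z Z≤z → P⇒Q (P-from-Z z Z≤z)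

  EventuallyPositiveNondecreasing : (ℕ → ℤ) → Set
  EventuallyPositiveNondecreasing h = Eventually λ z → 1ℤ ≤ h z × h z ≤ h (suc z)

  EventuallyPositiveIncreasing : (ℕ → ℤ) → Set
  EventuallyPositiveIncreasing h = Eventually λ z → 1ℤ ≤ h z × h z < h (suc z)

  evalℕ : Poly → ℕ → ℤ
  evalℕ f z = eval f (+ z)

  negate : Poly → Poly
  negate = map -_

  eval-negate : ∀ f x → eval (negate f) x ≡ - eval f x
  eval-negate []      x = refl
  eval-negate (a ∷ f) x = begin
    - a + x * eval (negate f) x ≡⟨ cong (λ v → - a + x * v) (eval-negate f x) ⟩
    - a + x * - eval f x        ≡⟨ cong (λ v → - a + v) (neg-distribʳ-* x (eval f x)) ⟨
    - a + - (x * eval f x)      ≡⟨ neg-distrib-+ a (x * eval f x) ⟨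
    - (a + x * eval f x)        ∎
    where open ≡-Reasoning

  eval-zeros : ∀ {r} → All (_≡ 0ℤ) r → ∀ x → eval r x ≡ 0ℤ
  eval-zeros []                   x = refl
  eval-zeros {_ ∷ r} (refl ∷ r≡0) x = begin
    0ℤ + x * eval r x ≡⟨ +-identityˡ (x * eval r x) ⟩
    x * eval r x      ≡⟨ cong (x *_) (eval-zeros r≡0 x) ⟩
    x * 0ℤ            ≡⟨ *-zeroʳ x ⟩
    0ℤ                ∎
    where open ≡-Reasoning

  eval-constant : ∀ a {r} → All (_≡ 0ℤ) r → ∀ x → eval (a ∷ r) x ≡ a
  eval-constant a {r} r≡0 x = begin
    a + x * eval r x ≡⟨ cong (λ v → a + x * v) (eval-zeros r≡0 x) ⟩
    a + x * 0ℤ       ≡⟨ cong (λ v → a + v) (*-zeroʳ x) ⟩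
    a + 0ℤ           ≡⟨ +-identityʳ a ⟩
    a                ∎
    where open ≡-Reasoning

  constant⇒EventuallyPositiveNondecreasing : ∀ {h c} → (∀ z → h z ≡ c) → 1ℤ ≤ c →
                                            EventuallyPositiveNondecreasing h
  constant⇒EventuallyPositiveNondecreasing {h} {c} h≡c 1≤c =
    0 , λ z _ → subst (1ℤ ≤_) (sym (h≡c z)) 1≤c , ≤-reflexive (trans (h≡c z) (sym (h≡c (suc z))))

  1≤i+[1+∣i∣] : ∀ i → 1ℤ ≤ i + + suc ∣ i ∣
  1≤i+[1+∣i∣] (+ n)    = +≤+ (ℕ.≤-trans (s≤s z≤n) (ℕ.m≤n+m (suc n) n))
  1≤i+[1+∣i∣] -[1+ n ] = ≤-reflexive (sym (begin
    suc (suc n) ⊖ suc n ≡⟨ [1+m]⊖[1+n]≡m⊖n (suc n) n ⟩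
    suc n ⊖ n           ≡⟨ ⊖-≥ (ℕ.n≤1+n n) ⟩
    + (suc n ℕ.∸ n)     ≡⟨ cong +_ (ℕ.m+n∸n≡m 1 n) ⟩
    1ℤ                  ∎))
    where open ≡-Reasoning

  horner-step : ∀ a {q : ℕ → ℤ} → EventuallyPositiveNondecreasing q →
                EventuallyPositiveIncreasing (λ z → a + + z * q z)
  horner-step a {q} (Z , q↑) = Z ⊔ suc ∣ a ∣ , λ z Z′≤z →
    let (1≤qz , qz≤qz′) = q↑ z (ℕ.≤-trans (ℕ.m≤m⊔n Z _) Z′≤z)
        (1≤qz′ , _)     = q↑ (suc z) (ℕ.≤-trans (ℕ.m≤m⊔n Z _) (ℕ.m≤n⇒m≤1+n Z′≤z))
        1+∣a∣≤z         = ℕ.≤-trans (ℕ.m≤n⊔m Z _) Z′≤z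
    in (begin
         1ℤ              ≤⟨ 1≤i+[1+∣i∣] a ⟩
         a + + suc ∣ a ∣ ≤⟨ +-monoʳ-≤ a (+≤+ 1+∣a∣≤z) ⟩
         a + + z         ≡⟨ cong (λ v → a + v) (*-identityʳ (+ z)) ⟨
         a + + z * 1ℤ    ≤⟨ +-monoʳ-≤ a (*-monoˡ-≤-nonNeg (+ z) 1≤qz) ⟩
         a + + z * q z   ∎)
     , +-monoʳ-< a (begin-strict
         + z * q z                   ≤⟨ *-monoˡ-≤-nonNeg (+ z) qz≤qz′ ⟩
         + z * q (suc z)             ≡⟨ +-identityˡ (+ z * q (suc z)) ⟨
         0ℤ + + z * q (suc z)        <⟨ +-monoˡ-< (+ z * q (suc z)) (<-≤-trans (+<+ (s≤s z≤n)) 1≤qz′) ⟩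
         q (suc z) + + z * q (suc z) ≡⟨ suc-* (+ z) (q (suc z)) ⟨
         + suc z * q (suc z)         ∎)
    where open ≤-Reasoning

  EventuallySignedNondecreasing : Poly → Set
  EventuallySignedNondecreasing f =
    EventuallyPositiveNondecreasing (evalℕ f) ⊎ EventuallyPositiveNondecreasing (evalℕ (negate f))

  EventuallySignedIncreasing : Poly → Set
  EventuallySignedIncreasing f =
    EventuallyPositiveIncreasing (evalℕ f) ⊎ EventuallyPositiveIncreasing (evalℕ (negate f))

  horner-step± : ∀ a {r} → EventuallySignedNondecreasing r → EventuallySignedIncreasing (a ∷ r)
  horner-step± a (inj₁ r↑) = inj₁ (horner-step a r↑)
  horner-step± a (inj₂ r↓) = inj₂ (horner-step (- a) r↓)

  Increasing⇒Nondecreasing : ∀ {f} → EventuallySignedIncreasing f → EventuallySignedNondecreasing f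
  Increasing⇒Nondecreasing = map⊎ weaken weaken
    where
    weaken : ∀ {h} → EventuallyPositiveIncreasing h → EventuallyPositiveNondecreasing h
    weaken = Eventually-map (map₂ <⇒≤)

  zero-or-eventually-signed : ∀ f → All (_≡ 0ℤ) f ⊎ EventuallySignedNondecreasing f
  zero-or-eventually-signed []      = inj₁ []
  zero-or-eventually-signed (a ∷ r) with zero-or-eventually-signed r
  ... | inj₂ r± = inj₂ (Increasing⇒Nondecreasing {a ∷ r} (horner-step± a {r} r±))
  ... | inj₁ r≡0 with a
  ...   | + 0      = inj₁ (refl ∷ r≡0)
  ...   | +[1+ n ] = inj₂ (inj₁ (constant⇒EventuallyPositiveNondecreasing
                                  (λ z → eval-constant +[1+ n ] r≡0 (+ z)) (+≤+ (s≤s z≤n))))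
  ...   | -[1+ n ] = inj₂ (inj₂ (constant⇒EventuallyPositiveNondecreasing
                                  (λ z → trans (eval-negate (-[1+ n ] ∷ r) (+ z))
                                               (cong -_ (eval-constant -[1+ n ] r≡0 (+ z))))
                                  (+≤+ (s≤s z≤n))))

  NonConstant⇒EventuallySignedIncreasing : ∀ f → NonConstant f → EventuallySignedIncreasing f
  NonConstant⇒EventuallySignedIncreasing (a ∷ r) r≢0 with zero-or-eventually-signed r
  ... | inj₁ r≡0 = contradiction r≢0 (All¬⇒¬Any (All.map (λ a≡0 a≢0 → a≢0 a≡0) r≡0))
  ... | inj₂ r±  = horner-step± a {r} r±

  ∣eval∣ : Poly → ℕ → ℕ
  ∣eval∣ f z = ∣ evalℕ f z ∣

  ∣eval-negate∣ : ∀ f z → ∣eval∣ (negate f) z ≡ ∣eval∣ f z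
  ∣eval-negate∣ f z = trans (cong ∣_∣ (eval-negate f (+ z))) (∣-i∣≡∣i∣ (evalℕ f z))

  positive-<⇒∣∣-< : ∀ {i j} → 1ℤ ≤ i × i < j → 1 ℕ.≤ ∣ i ∣ × ∣ i ∣ ℕ.< ∣ j ∣
  positive-<⇒∣∣-< (+≤+ 1≤m , +<+ m<n) = 1≤m , m<n

  NonConstant⇒∣eval∣-eventually-increasing : ∀ f → NonConstant f →
    Eventually λ z → 1 ℕ.≤ ∣eval∣ f z × ∣eval∣ f z ℕ.< ∣eval∣ f (suc z)
  NonConstant⇒∣eval∣-eventually-increasing f nc with NonConstant⇒EventuallySignedIncreasing f nc
  ... | inj₁ f↑ = Eventually-map positive-<⇒∣∣-< f↑
  ... | inj₂ f↓ = Eventually-map (λ {z} → negate-to-f z ∘′ positive-<⇒∣∣-<) f↓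
    where
    negate-to-f : ∀ z → 1 ℕ.≤ ∣eval∣ (negate f) z × ∣eval∣ (negate f) z ℕ.< ∣eval∣ (negate f) (suc z) →
                        1 ℕ.≤ ∣eval∣ f z × ∣eval∣ f z ℕ.< ∣eval∣ f (suc z)
    negate-to-f z = subst₂ (λ m n → 1 ℕ.≤ m × m ℕ.< n) (∣eval-negate∣ f z) (∣eval-negate∣ f (suc z))

  ‖_‖₁ : Poly → ℕ
  ‖ f ‖₁ = sum (map ∣_∣ f)

  ∣eval∣≤‖‖₁*^length : ∀ f {z} → 1 ℕ.≤ z → ∣eval∣ f z ℕ.≤ ‖ f ‖₁ ℕ.* z ℕ.^ length f
  ∣eval∣≤‖‖₁*^length []      _   = z≤n
  ∣eval∣≤‖‖₁*^length (a ∷ q) {z} 1≤z = begin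
    ∣ a + + z * evalℕ q z ∣                      ≤⟨ ∣i+j∣≤∣i∣+∣j∣ a (+ z * evalℕ q z) ⟩
    ∣ a ∣ ℕ.+ ∣ + z * evalℕ q z ∣                ≡⟨ cong (∣ a ∣ ℕ.+_) (abs-* (+ z) (evalℕ q z)) ⟩
    ∣ a ∣ ℕ.+ z ℕ.* ∣eval∣ q z                   ≤⟨ ℕ.+-mono-≤ ∣a∣≤∣a∣*zw
                                                     (ℕ.*-monoʳ-≤ z (∣eval∣≤‖‖₁*^length q 1≤z)) ⟩
    ∣ a ∣ ℕ.* (z ℕ.* w) ℕ.+ z ℕ.* (‖ q ‖₁ ℕ.* w) ≡⟨ rearrange ∣ a ∣ ‖ q ‖₁ z w ⟩
    (∣ a ∣ ℕ.+ ‖ q ‖₁) ℕ.* (z ℕ.* w)             ∎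
    where
    open ℕ.≤-Reasoning
    w = z ℕ.^ length q
    ∣a∣≤∣a∣*zw : ∣ a ∣ ℕ.≤ ∣ a ∣ ℕ.* (z ℕ.* w)
    ∣a∣≤∣a∣*zw = ℕ.m≤m*n ∣ a ∣ (z ℕ.* w) {{ℕ.m^n≢0 z (suc (length q)) {{ℕ.>-nonZero 1≤z}}}}
    rearrange : ∀ a s z w → a ℕ.* (z ℕ.* w) ℕ.+ z ℕ.* (s ℕ.* w) ≡ (a ℕ.+ s) ℕ.* (z ℕ.* w)
    rearrange = solve-∀

  gval≡∣eval∣²+3 : ∀ f z → gval f z ≡ ∣eval∣ f z ℕ.* ∣eval∣ f z ℕ.+ 3
  gval≡∣eval∣²+3 f z with evalℕ f z
  ... | + n      = cong (λ i → ∣ i + + 3 ∣) (+◃n≡+n (n ℕ.* n))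
  ... | -[1+ n ] = refl

open IntegerPolynomial

open import Data.Nat
open import Data.Nat.Properties
open import Data.Nat.Divisibility using (_∣_; divides; _∣?_; 0∣⇒≡0; ∣⇒≤)
open import Data.Nat.Induction using (<-rec)
open import Data.Nat.Tactic.RingSolver using (solve; solve-∀)

Unique⇒lookup-injective : ∀ {A : Set} {xs : List A} → Unique xs →
                          ∀ i j → List.lookup xs i ≡ List.lookup xs j → i ≡ j
Unique⇒lookup-injective (x∉xs AllPairs.∷ _) Fin.zero Fin.zero _ = refl
Unique⇒lookup-injective (x∉xs AllPairs.∷ _) Fin.zero (Fin.suc j) eq =
  contradiction eq (All.lookup x∉xs (∈-lookup j))
Unique⇒lookup-injective (x∉xs AllPairs.∷ _) (Fin.suc i) Fin.zero eq =
  contradiction (sym eq) (All.lookup x∉xs (∈-lookup i))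
Unique⇒lookup-injective (_ AllPairs.∷ xs!) (Fin.suc i) (Fin.suc j) eq =
  cong Fin.suc (Unique⇒lookup-injective xs! i j eq)

length≤-by-coding : ∀ {A C : Set} {M} → C ↣ Fin M → {HasCode : A → C → Set} →
                    (∀ {a b c} → HasCode a c → HasCode b c → a ≡ b) →
                    ∀ {zs} → Unique zs → All (λ z → ∃ (HasCode z)) zs → length zs ≤ M
length≤-by-coding {C = C} encode {HasCode} code-determines {zs} zs! coded = ≮⇒≥ λ M<len →
  let (i , j , i<j , same-code) = pigeonhole M<len (λ i → to (code i))
      zᵢ-has-codeⱼ = subst (HasCode _) (sym (injective same-code)) (has-code j)
  in Finₚ.<⇒≢ i<j (Unique⇒lookup-injective zs! i j (code-determines (has-code i) zᵢ-has-codeⱼ))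
  where
  open Injection encode
  coding : ∀ i → ∃ (HasCode (List.lookup zs i))
  coding i = All.lookup coded (∈-lookup i)
  code : Fin (length zs) → C
  code i = proj₁ (coding i)
  has-code : ∀ i → HasCode (List.lookup zs i) (code i)
  has-code i = proj₂ (coding i)

HasSquareFactor : ℕ → ℕ → Set
HasSquareFactor n k = 2 ≤ k × k * k ∣ n

no-square-factor⇒SquareFree : ∀ {n} → 1 ≤ n →
  ¬ (∃ λ k → k < suc n × HasSquareFactor n k) → SquareFree n
no-square-factor⇒SquareFree 1≤n none 0 0∣n = contradiction (0∣⇒≡0 0∣n) (>⇒≢ 1≤n)
no-square-factor⇒SquareFree 1≤n none 1 _   = refl
no-square-factor⇒SquareFree {n} 1≤n none k@(suc (suc _)) kk∣n =
  contradiction (k , s≤s k≤n , s≤s (s≤s z≤n) , kk∣n) none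
  where
  k≤n : k ≤ n
  k≤n = ≤-trans (m≤m*n k k) (∣⇒≤ {{>-nonZero 1≤n}} kk∣n)

IsSfPart-*-square : ∀ {m d} k → IsSfPart m d → IsSfPart (m * (k * k)) d
IsSfPart-*-square {m} {d} k (sf , e , m≡d*ee) = sf , e * k , (begin
  m * (k * k)           ≡⟨ cong (_* (k * k)) m≡d*ee ⟩
  d * (e * e) * (k * k) ≡⟨ solve (d ∷ e ∷ k ∷ []) ⟩
  d * (e * k * (e * k)) ∎)
  where open ≡-Reasoning

sfPart-exists : ∀ n → 1 ≤ n → ∃[ d ] IsSfPart n d
sfPart-exists = <-rec (λ n → 1 ≤ n → ∃[ d ] IsSfPart n d) step
  where
  step : ∀ n → (∀ {m} → m < n → 1 ≤ m → ∃[ d ] IsSfPart m d) → 1 ≤ n → ∃[ d ] IsSfPart n d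
  step n rec 1≤n with anyUpTo? (λ k → (2 ≤? k) ×-dec (k * k ∣? n)) (suc n)
  ... | no none = n , no-square-factor⇒SquareFree 1≤n none , 1 , sym (*-identityʳ n)
  ... | yes (k , _ , 2≤k , divides m refl) =
    let (d , m≡d□) = rec m<m*kk 1≤m in d , IsSfPart-*-square k m≡d□
    where
    1≤m : 1 ≤ m
    1≤m = n≢0⇒n>0 λ { refl → >⇒≢ 1≤n refl }
    1<k*k : 1 < k * k
    1<k*k = <-≤-trans 2≤k (m≤m*n k k {{>-nonZero (<-trans z<s 2≤k)}})
    m<m*kk : m < m * (k * k)
    m<m*kk = m<m*n m (k * k) {{>-nonZero 1≤m}} 1<k*k

square-injective : ∀ {x y} → x * x ≡ y * y → x ≡ y
square-injective {x} {y} eq with <-cmp x y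
... | tri< x<y _ _ = contradiction eq (<⇒≢ (*-mono-< x<y x<y))
... | tri≈ _ x≡y _ = x≡y
... | tri> _ _ y<x = contradiction (sym eq) (<⇒≢ (*-mono-< y<x y<x))

squares-order : ∀ {P Q a b} → P * P + b ≡ Q * Q + a → a < b → P < Q
squares-order eq a<b = ≰⇒> λ Q≤P → <-irrefl (sym eq) (+-mono-≤-< (*-mono-≤ Q≤P Q≤P) a<b)

squares-gap : ∀ {P Q a b} → P * P + b ≡ Q * Q + a → P < Q → P + Q + a ≤ b
squares-gap {P} {a = a} {b} eq P<Q with m≤n⇒∃[o]m+o≡n P<Q
... | o , refl = begin
  P + Q + a           ≤⟨ +-monoˡ-≤ a (m≤n*m (P + Q) (suc o)) ⟩
  suc o * (P + Q) + a ≡⟨ +-cancelˡ-≡ (P * P) _ _ (trans (expand P o a) (sym eq)) ⟩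
  b                   ∎
  where
  open ≤-Reasoning
  Q = suc P + o
  expand : ∀ P o a → P * P + (suc o * (P + (suc P + o)) + a) ≡ (suc P + o) * (suc P + o) + a
  expand = solve-∀

record PellSolution (d x e : ℕ) : Set where
  constructor pell
  field equation : x * x + 3 ≡ d * (e * e)

PellSolution⇒1≤e : ∀ {d x e} → PellSolution d x e → 1 ≤ e
PellSolution⇒1≤e {d} {x} {zero} (pell eq) = contradiction (m+n≡0⇒n≡0 (x * x) (trans eq (*-zeroʳ d))) λ ()
PellSolution⇒1≤e {e = suc _}    _         = s≤s z≤n

PellSolution⇒e≤x : ∀ {d x e} → PellSolution d x e → 2 ≤ x → e ≤ x
PellSolution⇒e≤x {zero} {x} (pell eq) _ = contradiction (m+n≡0⇒n≡0 (x * x) eq) λ ()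
PellSolution⇒e≤x {d@(suc _)} {x} {e} (pell eq) (s≤s (s≤s {n = y} _)) = ≮⇒≥ λ x<e →
  <-irrefl refl (begin-strict
    x * x + 3                     <⟨ m<m+n (x * x + 3) {suc (suc (2 * y))} z<s ⟩
    x * x + 3 + suc (suc (2 * y)) ≡⟨ solve (y ∷ []) ⟩
    suc x * suc x                 ≤⟨ *-mono-≤ x<e x<e ⟩
    e * e                         ≤⟨ m≤n*m (e * e) d ⟩
    d * (e * e)                   ≡⟨ eq ⟨
    x * x + 3                     ∎)
  where open ≤-Reasoning

PellSolution-unique-x : ∀ {d x₁ x₂ e} → PellSolution d x₁ e → PellSolution d x₂ e → x₁ ≡ x₂
PellSolution-unique-x {x₁ = x₁} {x₂} (pell eq₁) (pell eq₂) =
  square-injective (+-cancelʳ-≡ 3 (x₁ * x₁) (x₂ * x₂) (trans eq₁ (sym eq₂)))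

PellSolution-cross : ∀ {d x₁ e₁ x₂ e₂} → PellSolution d x₁ e₁ → PellSolution d x₂ e₂ →
  x₁ * e₂ * (x₁ * e₂) + 3 * (e₂ * e₂) ≡ x₂ * e₁ * (x₂ * e₁) + 3 * (e₁ * e₁)
PellSolution-cross {d} {x₁} {e₁} {x₂} {e₂} (pell eq₁) (pell eq₂) = begin
  x₁ * e₂ * (x₁ * e₂) + 3 * (e₂ * e₂) ≡⟨ solve (x₁ ∷ e₂ ∷ []) ⟩
  (x₁ * x₁ + 3) * (e₂ * e₂)           ≡⟨ cong (_* (e₂ * e₂)) eq₁ ⟩
  d * (e₁ * e₁) * (e₂ * e₂)           ≡⟨ solve (d ∷ e₁ ∷ e₂ ∷ []) ⟩
  d * (e₂ * e₂) * (e₁ * e₁)           ≡⟨ cong (_* (e₁ * e₁)) eq₂ ⟨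
  (x₂ * x₂ + 3) * (e₁ * e₁)           ≡⟨ solve (x₂ ∷ e₁ ∷ []) ⟩
  x₂ * e₁ * (x₂ * e₁) + 3 * (e₁ * e₁) ∎
  where open ≡-Reasoning

ratio>4/3 : ∀ {a b} → 1 ≤ a → a * b + b * a + 3 * (a * a) ≤ 3 * (b * b) → 4 * a < 3 * b
ratio>4/3 {a} {b} 1≤a ineq = ≰⇒> λ 3b≤4a →
  let instance _ = >-nonZero 1≤a
      3aa≤2ab : 3 * (a * a) ≤ 2 * (a * b)
      3aa≤2ab = +-cancelˡ-≤ (2 * (a * b)) _ _ (begin
        2 * (a * b) + 3 * (a * a)   ≡⟨ solve (a ∷ b ∷ []) ⟩
        a * b + b * a + 3 * (a * a) ≤⟨ ineq ⟩
        3 * (b * b)                 ≡⟨ *-assoc 3 b b ⟨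
        3 * b * b                   ≤⟨ *-monoˡ-≤ b 3b≤4a ⟩
        4 * a * b                   ≡⟨ solve (a ∷ b ∷ []) ⟩
        2 * (a * b) + 2 * (a * b)   ∎)
      3a≤2b : 3 * a ≤ 2 * b
      3a≤2b = *-cancelˡ-≤ a (begin
        a * (3 * a) ≡⟨ solve (a ∷ []) ⟩
        3 * (a * a) ≤⟨ 3aa≤2ab ⟩
        2 * (a * b) ≡⟨ solve (a ∷ b ∷ []) ⟩
        a * (2 * b) ∎)
  in <-irrefl refl (begin-strict
    8 * a       <⟨ m<m+n (8 * a) 1≤a ⟩
    8 * a + a   ≡⟨ solve (a ∷ []) ⟩
    3 * (3 * a) ≤⟨ *-monoʳ-≤ 3 3a≤2b ⟩
    3 * (2 * b) ≡⟨ solve (b ∷ []) ⟩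
    2 * (3 * b) ≤⟨ *-monoʳ-≤ 2 3b≤4a ⟩
    2 * (4 * a) ≡⟨ solve (a ∷ []) ⟩
    8 * a       ∎)
  where open ≤-Reasoning

cube-doubling : ∀ {a b} → 4 * a < 3 * b → 2 * (a * a * a) < b * b * b
cube-doubling {a} {b} 4a<3b = *-cancelˡ-< 27 (2 * (a * a * a)) (b * b * b) (begin-strict
  27 * (2 * (a * a * a))                    ≤⟨ m≤m+n (27 * (2 * (a * a * a))) (10 * (a * a * a)) ⟩
  27 * (2 * (a * a * a)) + 10 * (a * a * a) ≡⟨ solve (a ∷ []) ⟩
  4 * a * (4 * a) * (4 * a)                 <⟨ *-mono-< (*-mono-< 4a<3b 4a<3b) 4a<3b ⟩
  3 * b * (3 * b) * (3 * b)                 ≡⟨ solve (b ∷ []) ⟩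
  27 * (b * b * b)                          ∎)
  where open ≤-Reasoning

-- With P = x₁e₂ and Q = x₂e₁ we have Q² − P² = 3(e₂² − e₁²) > 0, so Q² − P² ≥ P + Q ≥ 2e₁e₂.
PellSolution-lacunary : ∀ {d x₁ e₁ x₂ e₂} → PellSolution d x₁ e₁ → PellSolution d x₂ e₂ →
                        2 ≤ x₁ → 2 ≤ x₂ → e₁ < e₂ → 2 * (e₁ * e₁ * e₁) < e₂ * e₂ * e₂
PellSolution-lacunary {d} {x₁} {e₁} {x₂} {e₂} sol₁ sol₂ 2≤x₁ 2≤x₂ e₁<e₂ =
  cube-doubling {e₁} {e₂} (ratio>4/3 {e₁} {e₂} (PellSolution⇒1≤e sol₁) (begin
    e₁ * e₂ + e₂ * e₁ + 3 * (e₁ * e₁) ≤⟨ +-monoˡ-≤ _ (+-mono-≤ (*-monoˡ-≤ e₂ e₁≤x₁) (*-monoˡ-≤ e₁ e₂≤x₂)) ⟩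
    P + Q + 3 * (e₁ * e₁)             ≤⟨ squares-gap {P} {Q} cross (squares-order {P} {Q} cross 3e₁²<3e₂²) ⟩
    3 * (e₂ * e₂)                     ∎))
  where
  open ≤-Reasoning
  P = x₁ * e₂
  Q = x₂ * e₁
  cross : P * P + 3 * (e₂ * e₂) ≡ Q * Q + 3 * (e₁ * e₁)
  cross = PellSolution-cross sol₁ sol₂
  e₁≤x₁ : e₁ ≤ x₁
  e₁≤x₁ = PellSolution⇒e≤x sol₁ 2≤x₁
  e₂≤x₂ : e₂ ≤ x₂
  e₂≤x₂ = PellSolution⇒e≤x sol₂ 2≤x₂
  3e₁²<3e₂² : 3 * (e₁ * e₁) < 3 * (e₂ * e₂)
  3e₁²<3e₂² = *-monoʳ-< 3 (*-mono-< e₁<e₂ e₁<e₂)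

PowerRange : ℕ → ℕ → ℕ → Set
PowerRange b j n = b ^ j ≤ n × n < b ^ suc j

powerRange-exists : ∀ b t {n} → 1 ≤ n → n < b ^ t → ∃[ j ] j < t × PowerRange b j n
powerRange-exists b zero    1≤n n<1 = contradiction (<-≤-trans n<1 1≤n) (<-irrefl refl)
powerRange-exists b (suc t) {n} 1≤n n<b^[1+t] with n <? b ^ t
... | yes n<b^t = let (j , j<t , range) = powerRange-exists b t 1≤n n<b^t in j , m<n⇒m<1+n j<t , range
... | no  n≮b^t = t , ≤-refl , ≮⇒≥ n≮b^t , n<b^[1+t]

PowerRange⇒≤* : ∀ b j {m n} → PowerRange b j m → PowerRange b j n → n ≤ b * m
PowerRange⇒≤* b j (b^j≤m , _) (_ , n<b^[1+j]) = <⇒≤ (<-≤-trans n<b^[1+j] (*-monoʳ-≤ b b^j≤m))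

PellSolutions-in-same-range : ∀ {d x₁ e₁ x₂ e₂} j → PellSolution d x₁ e₁ → PellSolution d x₂ e₂ →
  2 ≤ x₁ → 2 ≤ x₂ → PowerRange 2 j (e₁ * e₁ * e₁) → PowerRange 2 j (e₂ * e₂ * e₂) → e₁ ≡ e₂
PellSolutions-in-same-range {e₁ = e₁} {e₂ = e₂} j sol₁ sol₂ 2≤x₁ 2≤x₂ range₁ range₂ with <-cmp e₁ e₂
... | tri< e₁<e₂ _ _ = contradiction (PowerRange⇒≤* 2 j range₁ range₂)
                                     (<⇒≱ (PellSolution-lacunary sol₁ sol₂ 2≤x₁ 2≤x₂ e₁<e₂))
... | tri≈ _ e₁≡e₂ _ = e₁≡e₂
... | tri> _ _ e₂<e₁ = contradiction (PowerRange⇒≤* 2 j range₂ range₁)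
                                     (<⇒≱ (PellSolution-lacunary sol₂ sol₁ 2≤x₂ 2≤x₁ e₂<e₁))

n<2^n : ∀ n → n < 2 ^ n
n<2^n zero    = z<s
n<2^n (suc n) = begin-strict
  1 + n         <⟨ +-mono-≤-< (m^n>0 2 n) (n<2^n n) ⟩
  2 ^ n + 2 ^ n ≡⟨ cong (2 ^ n +_) (+-identityʳ (2 ^ n)) ⟨
  2 ^ suc n     ∎
  where open ≤-Reasoning

4^n≡2^n*2^n : ∀ n → 4 ^ n ≡ 2 ^ n * 2 ^ n
4^n≡2^n*2^n n = begin
  (2 ^ 2) ^ n   ≡⟨ ^-*-assoc 2 2 n ⟩
  2 ^ (2 * n)   ≡⟨ cong (2 ^_) (*-comm 2 n) ⟩
  2 ^ (n * 2)   ≡⟨ ^-*-assoc 2 n 2 ⟨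
  (2 ^ n) ^ 2   ≡⟨ cong (2 ^ n *_) (*-identityʳ (2 ^ n)) ⟩
  2 ^ n * 2 ^ n ∎
  where open ≡-Reasoning

cube<2^3* : ∀ {e} B → e < 2 ^ B → e * e * e < 2 ^ (3 * B)
cube<2^3* {e} B e<2^B = begin-strict
  e * e * e             <⟨ *-mono-< (*-mono-< e<2^B e<2^B) e<2^B ⟩
  2 ^ B * 2 ^ B * 2 ^ B ≡⟨ *-assoc (2 ^ B) (2 ^ B) (2 ^ B) ⟩
  2 ^ B * (2 ^ B * 2 ^ B) ≡⟨ cong (λ t → 2 ^ B * (2 ^ B * t)) (*-identityʳ (2 ^ B)) ⟨
  (2 ^ B) ^ 3           ≡⟨ ^-*-assoc 2 B 3 ⟩
  2 ^ (B * 3)           ≡⟨ cong (2 ^_) (*-comm B 3) ⟩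
  2 ^ (3 * B)           ∎
  where open ≤-Reasoning

square≤2^ : ∀ u → 6 ≤ u → suc u * suc u ≤ 2 ^ u
square≤2^ u 6≤u with m≤n⇒∃[o]m+o≡n 6≤u
... | v , refl = from-7 v
  where
  from-7 : ∀ v → (7 + v) * (7 + v) ≤ 2 ^ (6 + v)
  from-7 zero    = m≤m+n 49 15
  from-7 (suc v) = begin
    (8 + v) * (8 + v)                         ≤⟨ m≤m+n _ (v * v + 12 * v + 34) ⟩
    (8 + v) * (8 + v) + (v * v + 12 * v + 34) ≡⟨ solve (v ∷ []) ⟩
    2 * ((7 + v) * (7 + v))                   ≤⟨ *-monoʳ-≤ 2 (from-7 v) ⟩
    2 * 2 ^ (6 + v)                           ∎
    where open ≤-Reasoning

linear≤2^-eventually : ∀ a b → Eventually (λ u → a + b * u ≤ 2 ^ u)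
linear≤2^-eventually a b = 6 + (a + b) , λ u U≤u → begin
  a + b * u             ≤⟨ +-mono-≤ (m≤m*n a (suc u)) (*-monoʳ-≤ b (n≤1+n u)) ⟩
  a * suc u + b * suc u ≡⟨ *-distribʳ-+ (suc u) a b ⟨
  (a + b) * suc u       ≤⟨ *-monoˡ-≤ (suc u) (m≤n⇒m≤1+n (≤-trans (m≤n+m (a + b) 6) U≤u)) ⟩
  suc u * suc u         ≤⟨ square≤2^ u (≤-trans (m≤m+n 6 (a + b)) U≤u) ⟩
  2 ^ u                 ∎
  where open ≤-Reasoning

K*[Z+t*A]≤t*t : ∀ {K Z A t} → K * Z ≤ t → suc (K * A) ≤ t → K * (Z + t * A) ≤ t * t
K*[Z+t*A]≤t*t {K} {Z} {A} {t} KZ≤t 1+KA≤t = begin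
  K * (Z + t * A)     ≡⟨ rearrange K Z t A ⟩
  K * Z + t * (K * A) ≤⟨ +-monoˡ-≤ (t * (K * A)) KZ≤t ⟩
  t + t * (K * A)     ≡⟨ *-suc t (K * A) ⟨
  t * suc (K * A)     ≤⟨ *-monoʳ-≤ t 1+KA≤t ⟩
  t * t               ∎
  where
  open ≤-Reasoning
  rearrange : ∀ K Z t A → K * (Z + t * A) ≡ K * Z + t * (K * A)
  rearrange = solve-∀

K*[Z+2^[1+u]*3c[2+u]]≤4^u : ∀ K Z c u → K * Z + suc (K * (12 * c)) + K * (6 * c) * u ≤ 2 ^ u →
                      K * (Z + 2 ^ suc u * (3 * (c * suc (suc u)))) ≤ 4 ^ u
K*[Z+2^[1+u]*3c[2+u]]≤4^u K Z c u linear≤2^u = begin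
  K * (Z + 2 ^ suc u * (3 * B))   ≡⟨ cong (λ t → K * (Z + t)) (regroup (2 ^ u) (3 * B)) ⟩
  K * (Z + 2 ^ u * (2 * (3 * B))) ≤⟨ K*[Z+t*A]≤t*t {K} {Z} KZ≤2^u 1+KA≤2^u ⟩
  2 ^ u * 2 ^ u                   ≡⟨ 4^n≡2^n*2^n u ⟨
  4 ^ u                           ∎
  where
  open ≤-Reasoning
  B = c * suc (suc u)
  regroup : ∀ t s → 2 * t * s ≡ t * (2 * s)
  regroup = solve-∀
  KZ≤2^u : K * Z ≤ 2 ^ u
  KZ≤2^u = ≤-trans (≤-trans (m≤m+n (K * Z) _) (m≤m+n _ (K * (6 * c) * u))) linear≤2^u
  1+KA≤2^u : suc (K * (2 * (3 * B))) ≤ 2 ^ u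
  1+KA≤2^u = begin
    suc (K * (2 * (3 * B)))                      ≡⟨ expand K c u ⟩
    suc (K * (12 * c)) + K * (6 * c) * u         ≤⟨ +-monoˡ-≤ (K * (6 * c) * u) (m≤n+m _ (K * Z)) ⟩
    K * Z + suc (K * (12 * c)) + K * (6 * c) * u ≤⟨ linear≤2^u ⟩
    2 ^ u                                        ∎
    where
    expand : ∀ K c u → suc (K * (2 * (3 * (c * suc (suc u))))) ≡ suc (K * (12 * c)) + K * (6 * c) * u
    expand = solve-∀

stepwise-increasing⇒increasing : ∀ {k : ℕ → ℕ} {Z} → (∀ {z} → Z ≤ z → k z < k (suc z)) →
                                 ∀ {a b} → Z ≤ a → a < b → k a < k b
stepwise-increasing⇒increasing {k} k↑ {a} {suc b} Z≤a (s≤s a≤b) with m≤n⇒m<n∨m≡n a≤b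
... | inj₁ a<b  = <-trans (stepwise-increasing⇒increasing k↑ Z≤a a<b) (k↑ (≤-trans Z≤a a≤b))
... | inj₂ refl = k↑ Z≤a

LargeAndInjectiveFrom : ℕ → (ℕ → ℕ) → Set
LargeAndInjectiveFrom Z₀ x = (∀ {z} → Z₀ ≤ z → 2 ≤ x z) × (∀ {a b} → Z₀ ≤ a → Z₀ ≤ b → x a ≡ x b → a ≡ b)

eventually-increasing⇒large-injective : ∀ {x : ℕ → ℕ} → Eventually (λ z → 1 ≤ x z × x z < x (suc z)) →
                                        ∃[ Z₀ ] LargeAndInjectiveFrom Z₀ x
eventually-increasing⇒large-injective {x} (Z , x↑) = suc Z , large , injective
  where
  increasing : ∀ {a b} → Z ≤ a → a < b → x a < x b
  increasing = stepwise-increasing⇒increasing (λ {z} Z≤z → proj₂ (x↑ z Z≤z))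
  large : ∀ {z} → Z < z → 2 ≤ x z
  large Z<z = ≤-<-trans (proj₁ (x↑ Z ≤-refl)) (increasing ≤-refl Z<z)
  injective : ∀ {a b} → Z < a → Z < b → x a ≡ x b → a ≡ b
  injective {a} {b} Z<a Z<b xa≡xb with <-cmp a b
  ... | tri< a<b _ _ = contradiction xa≡xb (<⇒≢ (increasing (<⇒≤ Z<a) a<b))
  ... | tri≈ _ a≡b _ = a≡b
  ... | tri> _ _ b<a = contradiction (sym xa≡xb) (<⇒≢ (increasing (<⇒≤ Z<b) b<a))

DensityZero-mono : ∀ {P Q : ℕ → Set} → (∀ {z} → Q z → P z) → DensityZero P → DensityZero Q
DensityZero-mono Q⇒P P-density k with P-density k
... | X₀ , bound = X₀ , λ X X₀≤X zs zs! inQ → bound X X₀≤X zs zs! (All.map (map₂ (map₂ Q⇒P)) inQ)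

-- Growth z^O(1), measured on the ranges z ≤ 4ⁿ whose square roots are the powers 2ⁿ.
PolynomialGrowth : ℕ → (ℕ → ℕ) → Set
PolynomialGrowth c x = ∀ {z n} → 1 ≤ z → z ≤ 4 ^ n → x z < 2 ^ (c * suc n)

∣eval∣-polynomial-growth : ∀ f → PolynomialGrowth (‖ f ‖₁ + 2 * length f) (∣eval∣ f)
∣eval∣-polynomial-growth f {z} {n} 1≤z z≤4^n = begin-strict
  ∣eval∣ f z                ≤⟨ ∣eval∣≤‖‖₁*^length f 1≤z ⟩
  H * z ^ L                 ≤⟨ *-monoʳ-≤ H (^-monoˡ-≤ L z≤4^n) ⟩
  H * (4 ^ n) ^ L           <⟨ *-monoˡ-< ((4 ^ n) ^ L) {{m^n≢0 (4 ^ n) L {{m^n≢0 4 n}}}} (n<2^n H) ⟩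
  2 ^ H * (4 ^ n) ^ L       ≡⟨ cong (2 ^ H *_) (trans (^-*-assoc 4 n L) (^-*-assoc 2 2 (n * L))) ⟩
  2 ^ H * 2 ^ (2 * (n * L)) ≡⟨ ^-distribˡ-+-* 2 H (2 * (n * L)) ⟨
  2 ^ (H + 2 * (n * L))     ≤⟨ ^-monoʳ-≤ 2 exponent-bound ⟩
  2 ^ ((H + 2 * L) * suc n) ∎
  where
  open ≤-Reasoning
  H = ‖ f ‖₁
  L = length f
  exponent-bound : H + 2 * (n * L) ≤ (H + 2 * L) * suc n
  exponent-bound = begin
    H + 2 * (n * L)                   ≤⟨ m≤m+n _ (2 * L + H * n) ⟩
    H + 2 * (n * L) + (2 * L + H * n) ≡⟨ rearrange H L n ⟩
    (H + 2 * L) * suc n               ∎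
    where
    rearrange : ∀ H L n → H + 2 * (n * L) + (2 * L + H * n) ≡ (H + 2 * L) * suc n
    rearrange = solve-∀

SfBelowSqrt : (ℕ → ℕ) → ℕ → Set
SfBelowSqrt x z = ∀ d₁ → IsSfPart (x z * x z + 3) d₁ → d₁ ^ 2 < z

module SfBelowSqrtCounting (x : ℕ → ℕ) (Z₀ : ℕ) (x≥2 : ∀ {z} → Z₀ ≤ z → 2 ≤ x z)
                           (x-injective : ∀ {a b} → Z₀ ≤ a → Z₀ ≤ b → x a ≡ x b → a ≡ b) where

  Code : ℕ → ℕ → Set
  Code D T = Fin Z₀ ⊎ (Fin D × Fin T)

  Code↣Fin : ∀ {D T} → Code D T ↣ Fin (Z₀ + D * T)
  Code↣Fin = ↔⇒↣ (↔-sym (↔-trans +↔⊎ (↔-refl ⊎-↔ *↔×)))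

  HasCode : ∀ {D T} → ℕ → Code D T → Set
  HasCode z (inj₁ i)       = toℕ i ≡ z
  HasCode z (inj₂ (i , j)) = Z₀ ≤ z × ∃[ e ] PellSolution (toℕ i) (x z) e × PowerRange 2 (toℕ j) (e * e * e)

  code-determines : ∀ {D T a b} {c : Code D T} → HasCode a c → HasCode b c → a ≡ b
  code-determines {c = inj₁ i} i≡a i≡b = trans (sym i≡a) i≡b
  code-determines {c = inj₂ (i , j)} (Z₀≤a , e , sol₁ , range₁) (Z₀≤b , _ , sol₂ , range₂)
    with refl ← PellSolutions-in-same-range (toℕ j) sol₁ sol₂ (x≥2 Z₀≤a) (x≥2 Z₀≤b) range₁ range₂
    = x-injective Z₀≤a Z₀≤b (PellSolution-unique-x sol₁ sol₂)

  code-exists : ∀ {X D B z} → X ≤ D * D → (∀ {z} → 1 ≤ z → z ≤ X → x z < 2 ^ B) →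
                1 ≤ z → z ≤ X → SfBelowSqrt x z → ∃ (HasCode {D} {3 * B} z)
  code-exists {X} {D} {B} {z} X≤D*D x<2^B 1≤z z≤X small with z <? Z₀
  ... | yes z<Z₀ = inj₁ (fromℕ< z<Z₀) , toℕ-fromℕ< z<Z₀
  ... | no  z≮Z₀ with sfPart-exists (x z * x z + 3) (≤-trans (s≤s z≤n) (m≤n+m 3 (x z * x z)))
  ...   | d , sf@(_ , e , x²+3≡de²) =
    let (j , j<3B , e³-range) = powerRange-exists 2 (3 * B) 1≤e³ (cube<2^3* B e<2^B)
    in inj₂ (fromℕ< d<D , fromℕ< j<3B) , Z₀≤z , e ,
       subst (λ i → PellSolution i (x z) e) (sym (toℕ-fromℕ< d<D)) sol ,
       subst (λ i → PowerRange 2 i (e * e * e)) (sym (toℕ-fromℕ< j<3B)) e³-range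
    where
    Z₀≤z : Z₀ ≤ z
    Z₀≤z = ≮⇒≥ z≮Z₀
    sol : PellSolution d (x z) e
    sol = pell x²+3≡de²
    d<D : d < D
    d<D = ≰⇒> λ D≤d → <⇒≱ (<-≤-trans (small d sf) (≤-trans z≤X X≤D*D))
                           (≤-trans (*-mono-≤ D≤d D≤d) (≤-reflexive (cong (d *_) (sym (*-identityʳ d)))))
    1≤e³ : 1 ≤ e * e * e
    1≤e³ = let 1≤e = PellSolution⇒1≤e sol in *-mono-≤ (*-mono-≤ 1≤e 1≤e) 1≤e
    e<2^B : e < 2 ^ B
    e<2^B = ≤-<-trans (PellSolution⇒e≤x sol (x≥2 Z₀≤z)) (x<2^B 1≤z z≤X)

  SfBelowSqrt-count : ∀ {X D B} → X ≤ D * D → (∀ {z} → 1 ≤ z → z ≤ X → x z < 2 ^ B) → ∀ {zs} → Unique zs →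
                      All (λ z → 1 ≤ z × z ≤ X × SfBelowSqrt x z) zs → length zs ≤ Z₀ + D * (3 * B)
  SfBelowSqrt-count {X} {D} {B} X≤D*D x<2^B zs! bad =
    length≤-by-coding (Code↣Fin {D} {3 * B}) {HasCode} (code-determines {D} {3 * B}) zs!
      (All.map (λ (1≤z , z≤X , small) → code-exists {X} {D} {B} X≤D*D x<2^B 1≤z z≤X small) bad)

  SfBelowSqrt-density-zero : ∀ c → PolynomialGrowth c x → DensityZero (SfBelowSqrt x)
  SfBelowSqrt-density-zero c x-growth k
    with U , linear≤2^u ← linear≤2^-eventually (suc k * Z₀ + suc (suc k * (12 * c))) (suc k * (6 * c))
    = 4 ^ U , bound
    where
    bracket : ∀ {X} → 4 ^ U ≤ X → ∃[ u ] PowerRange 4 u X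
    bracket {X} 4^U≤X =
      let (u , _ , range) = powerRange-exists 4 X (≤-trans (m^n>0 4 U) 4^U≤X) X<4^X in u , range
      where
      X<4^X : X < 4 ^ X
      X<4^X = <-≤-trans (n<2^n X) (^-monoˡ-≤ X (s≤s (s≤s z≤n)))
    bound : ∀ X → 4 ^ U ≤ X → ∀ zs → Unique zs → All (λ z → 1 ≤ z × z ≤ X × SfBelowSqrt x z) zs →
            suc k * length zs ≤ X
    bound X 4^U≤X zs zs! bad with u , 4^u≤X , X<4^[1+u] ← bracket 4^U≤X = begin
      suc k * length zs                                  ≤⟨ *-monoʳ-≤ (suc k) count ⟩
      suc k * (Z₀ + 2 ^ suc u * (3 * (c * suc (suc u)))) ≤⟨ K*[Z+2^[1+u]*3c[2+u]]≤4^u (suc k) Z₀ c u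
                                                              (linear≤2^u u U≤u) ⟩
      4 ^ u                                              ≤⟨ 4^u≤X ⟩
      X                                                  ∎
      where
      open ≤-Reasoning
      X≤D*D : X ≤ 2 ^ suc u * 2 ^ suc u
      X≤D*D = ≤-trans (<⇒≤ X<4^[1+u]) (≤-reflexive (4^n≡2^n*2^n (suc u)))
      x<2^B : ∀ {z} → 1 ≤ z → z ≤ X → x z < 2 ^ (c * suc (suc u))
      x<2^B 1≤z z≤X = x-growth {n = suc u} 1≤z (≤-trans z≤X (<⇒≤ X<4^[1+u]))
      count : length zs ≤ Z₀ + 2 ^ suc u * (3 * (c * suc (suc u)))
      count = SfBelowSqrt-count {X} {2 ^ suc u} {c * suc (suc u)} X≤D*D x<2^B zs! bad
      U≤u : U ≤ u
      U≤u = s≤s⁻¹ (≰⇒> λ 1+u≤U → <⇒≱ X<4^[1+u] (≤-trans (^-monoʳ-≤ 4 1+u≤U) 4^U≤X))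

lemma3p6 : (f : Poly) → NonConstant f →
    ∃[ N ] (1 ≤ N × DensityZero (λ z → ∀ d₁ → IsSfPart (gval f z) d₁ → d₁ ^ N < z))
lemma3p6 f nonconstant
  with Z₀ , ∣f∣≥2 , ∣f∣-injective ← eventually-increasing⇒large-injective
                                     (NonConstant⇒∣eval∣-eventually-increasing f nonconstant)
  = 2 , s≤s z≤n , DensityZero-mono gval-to-∣eval∣ ∣eval∣-density-zero
  where
  open SfBelowSqrtCounting (∣eval∣ f) Z₀ ∣f∣≥2 ∣f∣-injective using (SfBelowSqrt-density-zero)
  ∣eval∣-density-zero : DensityZero (SfBelowSqrt (∣eval∣ f))
  ∣eval∣-density-zero = SfBelowSqrt-density-zero (‖ f ‖₁ + 2 * length f) (∣eval∣-polynomial-growth f)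
  gval-to-∣eval∣ : ∀ {z} → (∀ d₁ → IsSfPart (gval f z) d₁ → d₁ ^ 2 < z) → SfBelowSqrt (∣eval∣ f) z
  gval-to-∣eval∣ {z} = subst (λ n → ∀ d₁ → IsSfPart n d₁ → d₁ ^ 2 < z) (gval≡∣eval∣²+3 f z)
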